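{- Let $T$ be a tree of order $n\geq 2$ with $\ell$ leaves and $s$ support vertices, such that $C(T)\neq\emptyset$. Then $$\gamma_{s}(T)\geq \frac{\left(2\lceil\frac{\delta^{*}}{2}\rceil-1\right)n+2(\ell-s+2)}{2\lceil\frac{\delta^{*}}{2}\rceil+1},$$ and this bound is sharp, i.e., equality holds for some such tree.
   Context: A signed dominating function (SDF) of $T$ is a function $f:V(T)\to\{ -1,1\}$ with $f(N[v])=\sum_{u\in N[v]}f(u)\geq 1$ for every vertex $v$, where $N[v]$ is the closed neighborhood; $\gamma_s(T)$ is the minimum of $\sum_{v} f(v)$ over all SDFs. A leaf is a vertex of degree $1$; a support vertex is a vertex adjacent to a leaf. Let $C(T)$ be the set of vertices of $T$ that are neither isolated, nor leaves, nor support vertices, and $\delta^{*}=\min\{\deg(v): v\in C(T)\}$. -}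

module Defs where

open import Data.Bool using (Bool; true; false; T; _∧_; not; if_then_else_)
open import Data.Nat using (ℕ; zero; suc; _+_; _≤_; _≡ᵇ_; ⌈_/2⌉)
open import Data.Integer as ℤ using (ℤ; +_; -[1+_])
open import Data.Fin using (Fin)
open import Data.List using (List; []; _∷_; length; _∷ʳ_)
open import Data.List.Relation.Unary.Linked using (Linked)
open import Data.List.Relation.Unary.Unique.Propositional using (Unique)
open import Data.Product using (Σ; _×_; ∃)
open import Relation.Binary.PropositionalEquality using (_≡_)
open import Relation.Nullary using (¬_)

sumℕ : ∀ {n} → (Fin n → ℕ) → ℕ
sumℕ {zero}  f = 0
sumℕ {suc n} f = f Fin.zero + sumℕ (λ i → f (Fin.suc i))

sumℤ : ∀ {n} → (Fin n → ℤ) → ℤ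
sumℤ {zero}  f = + 0
sumℤ {suc n} f = f Fin.zero ℤ.+ sumℤ (λ i → f (Fin.suc i))

anyFin : ∀ {n} → (Fin n → Bool) → Bool
anyFin {zero}  p = false
anyFin {suc n} p = if p Fin.zero then true else anyFin (λ i → p (Fin.suc i))

count : ∀ {n} → (Fin n → Bool) → ℕ
count p = sumℕ (λ i → if p i then 1 else 0)

record Graph (n : ℕ) : Set where
  field
    adj    : Fin n → Fin n → Bool
    sym    : ∀ u v → adj u v ≡ adj v u
    irrefl : ∀ v → adj v v ≡ false
open Graph public

module _ {n : ℕ} (G : Graph n) where

  Adj : Fin n → Fin n → Set
  Adj u v = T (adj G u v)

  data Walk : Fin n → Fin n → Set where
    [] : ∀ {u} → Walk u u
    _∷_ : ∀ {u w v} → Adj u w → Walk w v → Walk u v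

  Connected : Set
  Connected = ∀ u v → Walk u v

  HasCycle : Set
  HasCycle = Σ (Fin n) λ x → Σ (List (Fin n)) λ ys →
               2 ≤ length ys × Unique (x ∷ ys) × Linked Adj ((x ∷ ys) ∷ʳ x)

  Acyclic : Set
  Acyclic = ¬ HasCycle

  IsTree : Set
  IsTree = Connected × Acyclic

  deg : Fin n → ℕ
  deg v = count (adj G v)

  isLeaf : Fin n → Bool
  isLeaf v = deg v ≡ᵇ 1

  isSupport : Fin n → Bool
  isSupport v = anyFin (λ u → adj G v u ∧ isLeaf u)

  isIsolated : Fin n → Bool
  isIsolated v = deg v ≡ᵇ 0

  inC : Fin n → Bool
  inC v = not (isIsolated v) ∧ (not (isLeaf v) ∧ not (isSupport v))

  numLeaves : ℕ
  numLeaves = count isLeaf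

  numSupports : ℕ
  numSupports = count isSupport

  IsDeltaStar : ℕ → Set
  IsDeltaStar d = (Σ (Fin n) λ v → T (inC v) × deg v ≡ d)
                × (∀ v → T (inC v) → d ≤ deg v)

  -- a function V → {-1,1}, encoded by Bool (true ↦ +1, false ↦ -1)
  sign : Bool → ℤ
  sign true  = + 1
  sign false = -[1+ 0 ]

  weight : (Fin n → Bool) → ℤ
  weight f = sumℤ (λ v → sign (f v))

  closedNbhdSum : (Fin n → Bool) → Fin n → ℤ
  closedNbhdSum f v = sign (f v) ℤ.+ sumℤ (λ u → if adj G v u then sign (f u) else + 0)

  IsSDF : (Fin n → Bool) → Set
  IsSDF f = ∀ v → + 1 ℤ.≤ closedNbhdSum f v

  IsSignedDomNumber : ℤ → Set
  IsSignedDomNumber g = (Σ (Fin n → Bool) λ f → IsSDF f × weight f ≡ g)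
                      × (∀ f → IsSDF f → g ℤ.≤ weight f)

  CNonempty : Set
  CNonempty = Σ (Fin n) λ v → T (inC v)

boundNumerator : ℕ → ℕ → ℕ → ℕ → ℤ
boundNumerator n δ ℓ s =
  ((+ (2 Data.Nat.* ⌈ δ /2⌉)) ℤ.- + 1) ℤ.* + n ℤ.+ + 2 ℤ.* ((+ ℓ ℤ.- + s) ℤ.+ + 2)

boundDenominator : ℕ → ℕ
boundDenominator δ = 2 Data.Nat.* ⌈ δ /2⌉ + 1

module Submission where

-- Fix a minimum signed dominating function f with p vertices labelled +1 and m labelled −1, so that
-- γₛ = p − m and n = p + m.  Leaves and support vertices are forced to +1, so every −1 vertex v lies in
-- C(T), and f(N[v]) ≥ 1 gives it at least ⌈δ*/2⌉ + 1 neighbours labelled +1.  Every +1 vertex has a +1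
-- neighbour, and a support vertex has all its leaves as +1 neighbours.  Counting ends of edges of T,
--   (p + ℓ − s) + 2 (⌈δ*/2⌉ + 1) m ≤ Σ deg = 2 (n − 1),
-- that is ℓ + 2 + 2 ⌈δ*/2⌉ m ≤ p + s, which rearranges to the bound.  The path on five vertices attains it.

module SignedDomination where

  open import Defs hiding (sym)
  open import Data.Bool using (Bool; true; false; T; _∧_; _∨_; not; if_then_else_)
  open import Data.Bool.Properties using (∧-zeroʳ; ∧-identityʳ; ∧-comm; ∨-comm; ¬-not; T-≡; T-∧; T-∨)
  open import Data.Nat using (ℕ; zero; suc; _+_; _*_; _≤_; _<_; z≤n; s≤s; _≡ᵇ_; ⌈_/2⌉)
  open import Data.Nat.Properties hiding (_≟_)
  open import Data.Fin using (Fin; zero; suc; toℕ)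
  open import Data.Fin.Patterns using (0F; 1F; 2F; 3F; 4F)
  open import Data.Vec.Functional using (tail)
  open import Data.Fin.Properties using (_≟_)
  open import Data.Product using (∃; _,_; proj₁; proj₂)
  open import Data.Sum using (_⊎_; inj₁; inj₂)
  open import Data.Empty using (⊥-elim)
  open import Relation.Nullary using (¬_; Dec; yes; no; does; ¬?; _×-dec_)
  open import Relation.Nullary.Decidable using (T?; dec-true; dec-false; decidable-stable)
  open import Data.List using (List; []; _∷_; length; _∷ʳ_; [_])
  open import Data.List.Relation.Unary.Linked as Linked using (Linked; [-]; _∷_)
  open import Data.List.Relation.Unary.AllPairs using (AllPairs; []; _∷_)
  open import Data.List.Relation.Unary.All as All using (All; []; _∷_)
  open import Data.List.Relation.Unary.All.Properties as Allₚ using (¬Any⇒All¬)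
  open import Data.List.Relation.Unary.Any using (here; there)
  open import Data.List.Relation.Unary.Unique.Propositional using (Unique)
  open import Data.List.Membership.Propositional using (_∈_; _∉_)
  open import Data.List.Membership.Propositional.Properties using (∈-++⁺ʳ)
  open import Data.Fin.Properties using (any?; toℕ-injective)
  open import Data.Nat.Induction using (<-wellFounded)
  open import Induction.WellFounded using (Acc; acc)
  open import Function using (_∘_; case_of_; Equivalence)
  open import Relation.Binary.PropositionalEquality hiding ([_])
  open import Data.Nat.Tactic.RingSolver using (solve-∀)
  open import Data.Integer as ℤ using (ℤ; +_; -[1+_])
  import Data.Integer.Properties as ℤ
  import Data.Integer.Tactic.RingSolver as ℤ-Solver
  open import Algebra.Properties.Semiring.Sum +-*-semiring using (sum; sum-cong-≗; ∑-distrib-+; ∑-comm; *-distribˡ-sum)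

  private variable
    n : ℕ

  ∧-trueˡ : ∀ {a b} → a ∧ b ≡ true → a ≡ true
  ∧-trueˡ {true} _ = refl

  ∧-trueʳ : ∀ {a b} → a ∧ b ≡ true → b ≡ true
  ∧-trueʳ {true} b≡true = b≡true

  T⇒≡ : ∀ {b} → T b → b ≡ true
  T⇒≡ = Equivalence.to T-≡

  ≡⇒T : ∀ {b} → b ≡ true → T b
  ≡⇒T = Equivalence.from T-≡

  sumℕ≡sum : (f : Fin n → ℕ) → sumℕ f ≡ sum f
  sumℕ≡sum {zero}  f = refl
  sumℕ≡sum {suc n} f = cong (_+_ (f zero)) (sumℕ≡sum (λ i → f (suc i)))

  sumℕ-cong : {f g : Fin n → ℕ} → (∀ i → f i ≡ g i) → sumℕ f ≡ sumℕ g
  sumℕ-cong {f = f} {g} f≗g = begin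
    sumℕ f ≡⟨ sumℕ≡sum f ⟩ sum f ≡⟨ sum-cong-≗ f≗g ⟩ sum g ≡⟨ sumℕ≡sum g ⟨ sumℕ g ∎
    where open ≡-Reasoning

  sumℕ-+ : (f g : Fin n → ℕ) → sumℕ (λ i → f i + g i) ≡ sumℕ f + sumℕ g
  sumℕ-+ f g = begin
    sumℕ (λ i → f i + g i) ≡⟨ sumℕ≡sum (λ i → f i + g i) ⟩
    sum (λ i → f i + g i)  ≡⟨ ∑-distrib-+ f g ⟩
    sum f + sum g          ≡⟨ cong₂ _+_ (sumℕ≡sum f) (sumℕ≡sum g) ⟨
    sumℕ f + sumℕ g        ∎
    where open ≡-Reasoning

  sumℕ-*ˡ : (c : ℕ) (f : Fin n → ℕ) → sumℕ (λ i → c * f i) ≡ c * sumℕ f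
  sumℕ-*ˡ c f = begin
    sumℕ (λ i → c * f i) ≡⟨ sumℕ≡sum (λ i → c * f i) ⟩
    sum (λ i → c * f i)  ≡⟨ *-distribˡ-sum c f ⟨
    c * sum f            ≡⟨ cong (c *_) (sumℕ≡sum f) ⟨
    c * sumℕ f           ∎
    where open ≡-Reasoning

  sumℕ-comm : ∀ {m} (h : Fin n → Fin m → ℕ) →
              sumℕ (λ i → sumℕ (λ j → h i j)) ≡ sumℕ (λ j → sumℕ (λ i → h i j))
  sumℕ-comm h = begin
    sumℕ (λ i → sumℕ (h i))            ≡⟨ sumℕ-cong (λ i → sumℕ≡sum (h i)) ⟩
    sumℕ (λ i → sum (h i))             ≡⟨ sumℕ≡sum (λ i → sum (h i)) ⟩
    sum (λ i → sum (h i))              ≡⟨ ∑-comm h ⟩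
    sum (λ j → sum (λ i → h i j))      ≡⟨ sumℕ≡sum (λ j → sum (λ i → h i j)) ⟨
    sumℕ (λ j → sum (λ i → h i j))     ≡⟨ sumℕ-cong (λ j → sumℕ≡sum (λ i → h i j)) ⟨
    sumℕ (λ j → sumℕ (λ i → h i j))    ∎
    where open ≡-Reasoning

  sumℕ-zero : {f : Fin n → ℕ} → (∀ i → f i ≡ 0) → sumℕ f ≡ 0
  sumℕ-zero {zero}  f≗0 = refl
  sumℕ-zero {suc n} f≗0 = cong₂ _+_ (f≗0 zero) (sumℕ-zero (λ i → f≗0 (suc i)))

  sumℕ-mono : {f g : Fin n → ℕ} → (∀ i → f i ≤ g i) → sumℕ f ≤ sumℕ g
  sumℕ-mono {zero}  f≤g = z≤n
  sumℕ-mono {suc n} f≤g = +-mono-≤ (f≤g zero) (sumℕ-mono (λ i → f≤g (suc i)))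

  indicator : Bool → ℕ
  indicator b = if b then 1 else 0

  _==_ : Fin n → Fin n → Bool
  i == j = does (i ≟ j)

  ==-refl : (i : Fin n) → (i == i) ≡ true
  ==-refl i = dec-true (i ≟ i) refl

  ==-≢ : {i j : Fin n} → ¬ i ≡ j → (i == j) ≡ false
  ==-≢ {i = i} {j} = dec-false (i ≟ j)

  module _ {n : ℕ} where

    count-cong : {p q : Fin n → Bool} → (∀ i → p i ≡ q i) → count p ≡ count q
    count-cong p≗q = sumℕ-cong (λ i → cong indicator (p≗q i))

    count-none : (p : Fin n → Bool) → (∀ i → p i ≡ false) → count p ≡ 0
    count-none p none = sumℕ-zero (λ i → cong indicator (none i))

    count-mono : (p q : Fin n → Bool) → (∀ i → p i ≡ true → q i ≡ true) → count p ≤ count q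
    count-mono p q p⊆q = sumℕ-mono pointwise
      where
      pointwise : ∀ i → indicator (p i) ≤ indicator (q i)
      pointwise i with p i in pᵢ
      ... | false = z≤n
      ... | true rewrite p⊆q i pᵢ = ≤-refl

    count-split : (p q : Fin n → Bool) →
                  count p ≡ count (λ i → p i ∧ q i) + count (λ i → p i ∧ not (q i))
    count-split p q = trans (sumℕ-cong pointwise) (sumℕ-+ {n} _ _)
      where
      pointwise : ∀ i → indicator (p i) ≡ indicator (p i ∧ q i) + indicator (p i ∧ not (q i))
      pointwise i with p i | q i
      ... | true  | true  = refl
      ... | true  | false = refl
      ... | false | _     = refl

  count-∧-false : (p : Fin n → Bool) → count (λ i → p i ∧ false) ≡ 0
  count-∧-false p = count-none (λ i → p i ∧ false) (λ i → ∧-zeroʳ (p i))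

  count-all : count {n} (λ _ → true) ≡ n
  count-all {zero}  = refl
  count-all {suc n} = cong suc count-all

  count-+-count-not : (p : Fin n → Bool) → count p + count (not ∘ p) ≡ n
  count-+-count-not p = trans (sym (count-split (λ _ → true) p)) count-all

  count-≤ : (p : Fin n → Bool) → count p ≤ n
  count-≤ {zero}  p = z≤n
  count-≤ {suc n} p with p zero
  ... | true  = s≤s (count-≤ (λ i → p (suc i)))
  ... | false = m≤n⇒m≤1+n (count-≤ (λ i → p (suc i)))

  count-== : (p : Fin n → Bool) (a : Fin n) → count (λ i → p i ∧ (i == a)) ≡ indicator (p a)
  count-== {suc n} p zero
    rewrite ∧-identityʳ (p zero) | count-∧-false (λ i → p (suc i)) = +-identityʳ _
  count-== {suc n} p (suc a)
    rewrite ∧-zeroʳ (p zero) = count-== (λ i → p (suc i)) a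

  module _ {n : ℕ} where

    count-remove : (p : Fin n → Bool) (a : Fin n) →
                   count p ≡ indicator (p a) + count (λ i → p i ∧ not (i == a))
    count-remove p a = trans (count-split p (_== a)) (cong (_+ count (λ i → p i ∧ not (i == a))) (count-== p a))

    count-≥1 : (p : Fin n → Bool) (a : Fin n) → p a ≡ true → 1 ≤ count p
    count-≥1 p a pa rewrite count-remove p a | pa = s≤s z≤n

    count-≥2 : (p : Fin n → Bool) {a b : Fin n} → p a ≡ true → p b ≡ true → ¬ a ≡ b → 2 ≤ count p
    count-≥2 p {a} {b} pa pb a≢b rewrite count-remove p a | pa =
      s≤s (count-≥1 _ b (cong₂ _∧_ pb (cong not (==-≢ (a≢b ∘ sym)))))

    count-≤1 : (p : Fin n → Bool) (a : Fin n) → (∀ i → p i ≡ true → i ≡ a) → count p ≤ 1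
    count-≤1 p a only-a = begin
      count p                                             ≡⟨ count-remove p a ⟩
      indicator (p a) + count (λ i → p i ∧ not (i == a))  ≡⟨ cong (_+_ (indicator (p a))) (count-none _ others) ⟩
      indicator (p a) + 0                                 ≤⟨ indicator≤1 (p a) ⟩
      1                                                   ∎
      where
      open ≤-Reasoning
      indicator≤1 : ∀ b → indicator b + 0 ≤ 1
      indicator≤1 true  = ≤-refl
      indicator≤1 false = z≤n
      others : ∀ i → (p i ∧ not (i == a)) ≡ false
      others i with p i in pᵢ
      ... | false = refl
      ... | true rewrite only-a i pᵢ | ==-refl a = refl

    count-strict : (p q : Fin n → Bool) → (∀ i → p i ≡ true → q i ≡ true) →
                   (a : Fin n) → p a ≡ false → q a ≡ true → suc (count p) ≤ count q
    count-strict p q p⊆q a pa qa rewrite count-remove p a | count-remove q a | pa | qa =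
      s≤s (count-mono _ _ restrict)
      where
      restrict : ∀ i → (p i ∧ not (i == a)) ≡ true → (q i ∧ not (i == a)) ≡ true
      restrict i with p i in pᵢ
      ... | true rewrite p⊆q i pᵢ = λ not-a → not-a

  count-witness : (p : Fin n → Bool) → 1 ≤ count p → ∃ λ i → p i ≡ true
  count-witness p 1≤count with any? (T? ∘ p)
  ... | yes (i , pᵢ) = i , T⇒≡ pᵢ
  ... | no  none     with () ← ≤-trans 1≤count (≤-reflexive (count-none p (λ i → ¬-not (none ∘ (i ,_) ∘ ≡⇒T))))

  anyFin-witness : (p : Fin n → Bool) → anyFin p ≡ true → ∃ λ i → p i ≡ true
  anyFin-witness {suc n} p any-p with p zero in p₀
  ... | true  = zero , p₀
  ... | false = let i , pᵢ = anyFin-witness (λ i → p (suc i)) any-p in suc i , pᵢ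

  anyFin-none : (p : Fin n → Bool) → anyFin p ≡ false → ∀ i → p i ≡ false
  anyFin-none p none zero    with p zero
  ... | false = refl
  anyFin-none p none (suc i) with p zero
  ... | false = anyFin-none (λ i → p (suc i)) none i

  module _ {n : ℕ} (G : Graph n) where

    Adj-sym : ∀ {u v} → Adj G u v → Adj G v u
    Adj-sym {u} {v} = subst T (Graph.sym G u v)

    Adj-irrefl : ∀ {u v} → Adj G u v → ¬ u ≡ v
    Adj-irrefl {u} uu refl = subst T (Graph.irrefl G u) uu

    Adj⇒deg≥1 : ∀ {u v} → Adj G u v → 1 ≤ deg G u
    Adj⇒deg≥1 {u} {v} uv = count-≥1 (adj G u) v (T⇒≡ uv)

    isLeaf⇒deg≡1 : ∀ {v} → isLeaf G v ≡ true → deg G v ≡ 1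
    isLeaf⇒deg≡1 {v} leaf = ≡ᵇ⇒≡ (deg G v) 1 (≡⇒T leaf)

    walk⇒deg≥1 : ∀ {u v} → Walk G u v → ¬ u ≡ v → 1 ≤ deg G u
    walk⇒deg≥1 []       u≢u = ⊥-elim (u≢u refl)
    walk⇒deg≥1 (uw ∷ _) _   = Adj⇒deg≥1 uw

    walk-snoc : ∀ {u v w} → Walk G u v → Adj G v w → Walk G u w
    walk-snoc []       vw = vw ∷ []
    walk-snoc (ux ∷ p) vw = ux ∷ walk-snoc p vw

    walk-reverse : ∀ {u v} → Walk G u v → Walk G v u
    walk-reverse []       = []
    walk-reverse (ux ∷ p) = walk-snoc (walk-reverse p) (Adj-sym ux)

    walk-++ : ∀ {u v w} → Walk G u v → Walk G v w → Walk G u w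
    walk-++ []       q = q
    walk-++ (ux ∷ p) q = ux ∷ walk-++ p q

    connected-via : (r : Fin n) → (∀ v → Walk G v r) → Connected G
    connected-via r to-r u v = walk-++ (to-r u) (walk-reverse (to-r v))

    connected⇒deg≥1 : 2 ≤ n → Connected G → ∀ v → 1 ≤ deg G v
    connected⇒deg≥1 2≤n connected v = walk⇒deg≥1 (connected v (other 2≤n v)) (≢other 2≤n v)
      where
      other : ∀ {k} → 2 ≤ k → Fin k → Fin k
      other {suc (suc _)} _ zero    = suc zero
      other {suc (suc _)} _ (suc _) = zero
      other {suc zero} (s≤s ()) _
      ≢other : ∀ {k} (2≤k : 2 ≤ k) (v : Fin k) → ¬ v ≡ other 2≤k v
      ≢other {suc (suc _)} _ zero    ()
      ≢other {suc (suc _)} _ (suc _) ()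
      ≢other {suc zero} (s≤s ()) _

  -- Forests

  module _ {a} {A : Set a} where

    prefixTo : ∀ {x : A} {xs} → x ∈ xs → List A
    prefixTo {x} (here _)           = [ x ]
    prefixTo {xs = y ∷ _} (there x∈) = y ∷ prefixTo x∈

    All-prefixTo : ∀ {p} {P : A → Set p} {x xs} → All P xs → (x∈ : x ∈ xs) → All P (prefixTo x∈)
    All-prefixTo (px ∷ _)   (here refl) = px ∷ []
    All-prefixTo (py ∷ pxs) (there x∈)  = py ∷ All-prefixTo pxs x∈

    AllPairs-prefixTo : ∀ {r} {R : A → A → Set r} {x xs} → AllPairs R xs → (x∈ : x ∈ xs) →
                        AllPairs R (prefixTo x∈)
    AllPairs-prefixTo (_ ∷ _)    (here refl) = [] ∷ []
    AllPairs-prefixTo (ry ∷ rxs) (there x∈)  = All-prefixTo ry x∈ ∷ AllPairs-prefixTo rxs x∈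

    Linked-prefixTo-∷ʳ : ∀ {r} {R : A → A → Set r} {x y xs} → Linked R xs → (x∈ : x ∈ xs) → R x y →
                         Linked R (prefixTo x∈ ∷ʳ y)
    Linked-prefixTo-∷ʳ [-]          (here refl) rxy = rxy ∷ [-]
    Linked-prefixTo-∷ʳ (_ ∷ _)      (here refl) rxy = rxy ∷ [-]
    Linked-prefixTo-∷ʳ (rzw ∷ rest) (there x∈@(here refl)) rxy = rzw ∷ Linked-prefixTo-∷ʳ rest x∈ rxy
    Linked-prefixTo-∷ʳ (rzw ∷ rest) (there x∈@(there _)) rxy = rzw ∷ Linked-prefixTo-∷ʳ rest x∈ rxy

  module _ {n : ℕ} (G : Graph n) where
    open import Data.List.Membership.DecPropositional (_≟_ {n}) using (_∈?_)

    offPath : List (Fin n) → Fin n → Bool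
    offPath ps x = not (does (x ∈? ps))

    offPath-shrinks : ∀ {x ps} → x ∉ ps → count (offPath (x ∷ ps)) < count (offPath ps)
    offPath-shrinks {x} {ps} x∉ps =
      count-strict _ _ stays-off x (cong not (dec-true (x ∈? (x ∷ ps)) (here refl)))
                                   (cong not (dec-false (x ∈? ps) x∉ps))
      where
      stays-off : ∀ i → offPath (x ∷ ps) i ≡ true → offPath ps i ≡ true
      stays-off i i-off = cong not (dec-false (i ∈? ps) on-ps⇒on)
        where
        on-ps⇒on : i ∉ ps
        on-ps⇒on i∈ps with () ← trans (sym i-off) (cong not (dec-true (i ∈? (x ∷ ps)) (there i∈ps)))

    chord⇒cycle : ∀ {h p x t} → Unique (h ∷ p ∷ t) → Linked (Adj G) (h ∷ p ∷ t) →
                  x ∈ t → Adj G h x → HasCycle G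
    chord⇒cycle {h} {p} unique path x∈t hx =
      h , p ∷ prefixTo x∈t , s≤s (prefixTo-nonempty x∈t) ,
      AllPairs-prefixTo unique x∈path , Linked-prefixTo-∷ʳ path x∈path (Adj-sym G hx)
      where
      x∈path = there (there x∈t)
      prefixTo-nonempty : ∀ {y ys} (y∈ : y ∈ ys) → 1 ≤ length (prefixTo y∈)
      prefixTo-nonempty (here _)  = s≤s z≤n
      prefixTo-nonempty (there _) = s≤s z≤n

    maximal-path-end-is-leaf : Acyclic G → ∀ {h p t} → Unique (h ∷ p ∷ t) → Linked (Adj G) (h ∷ p ∷ t) →
                               (∀ x → Adj G h x → x ∈ h ∷ p ∷ t) → deg G h ≡ 1
    maximal-path-end-is-leaf acyclic {h} {p} unique path@(hp ∷ _) maximal =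
      ≤-antisym (count-≤1 (adj G h) p only-p) (Adj⇒deg≥1 G hp)
      where
      only-p : ∀ x → adj G h x ≡ true → x ≡ p
      only-p x hx≡ with hx ← ≡⇒T hx≡ | maximal x hx
      ... | here refl          = ⊥-elim (Adj-irrefl G hx refl)
      ... | there (here x≡p)   = x≡p
      ... | there (there x∈t)  = ⊥-elim (acyclic (chord⇒cycle unique path x∈t hx))

    leaf-exists : Acyclic G → ∀ {a b} → Adj G a b → ∃ λ u → deg G u ≡ 1
    leaf-exists acyclic ab =
      extend ((Adj-irrefl G (Adj-sym G ab) ∷ []) ∷ [] ∷ []) (Adj-sym G ab ∷ [-]) (<-wellFounded _)
      where
      extend : ∀ {h p t} → Unique (h ∷ p ∷ t) → Linked (Adj G) (h ∷ p ∷ t) →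
               Acc _<_ (count (offPath (h ∷ p ∷ t))) → ∃ λ u → deg G u ≡ 1
      extend {h} {p} {t} unique path (acc smaller)
        with any? (λ x → T? (adj G h x) ×-dec ¬? (x ∈? (h ∷ p ∷ t)))
      ... | yes (x , hx , x∉) =
        extend (¬Any⇒All¬ _ x∉ ∷ unique) (Adj-sym G hx ∷ path) (smaller (offPath-shrinks x∉))
      ... | no stuck =
        h , maximal-path-end-is-leaf acyclic unique path
              (λ x hx → decidable-stable (x ∈? (h ∷ p ∷ t)) (λ x∉ → stuck (x , hx , x∉)))

  isolate : Graph n → Fin n → Graph n
  isolate G u = record
    { adj    = λ a b → adj G a b ∧ (not (a == u) ∧ not (b == u))
    ; sym    = λ a b → cong₂ _∧_ (Graph.sym G a b) (∧-comm (not (a == u)) (not (b == u)))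
    ; irrefl = λ a → cong (_∧ _) (Graph.irrefl G a)
    }

  module _ {n : ℕ} (G : Graph n) (u : Fin n) where

    isolate-acyclic : Acyclic G → Acyclic (isolate G u)
    isolate-acyclic acyclic (x , ys , long , unique , cycle) =
      acyclic (x , ys , long , unique , Linked.map (proj₁ ∘ Equivalence.to T-∧) cycle)

    deg-isolate-self : deg (isolate G u) u ≡ 0
    deg-isolate-self rewrite ==-refl u = count-∧-false (adj G u)

    deg-isolate-other : ∀ {v} → ¬ v ≡ u → deg G v ≡ indicator (adj G v u) + deg (isolate G u) v
    deg-isolate-other {v} v≢u rewrite ==-≢ v≢u = count-remove (adj G v) u

    deg-isolate-≤ : ∀ v → deg (isolate G u) v ≤ deg G v
    deg-isolate-≤ v = count-mono (adj (isolate G u) v) (adj G v) (λ i → ∧-trueˡ)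

    deg-isolate : ∀ v → deg G v ≡ deg (isolate G u) v + indicator (adj G v u) + deg G u * indicator (v == u)
    deg-isolate v = by-cases (v ≟ u)
      where
      open ≡-Reasoning
      rearrange : ∀ a b c → a + b ≡ b + a + c * 0
      rearrange = solve-∀
      by-cases : Dec (v ≡ u) →
                 deg G v ≡ deg (isolate G u) v + indicator (adj G v u) + deg G u * indicator (v == u)
      by-cases (yes refl) = sym (begin
        deg (isolate G u) u + indicator (adj G u u) + deg G u * indicator (u == u)
          ≡⟨ cong₂ _+_ (cong₂ _+_ deg-isolate-self (cong indicator (Graph.irrefl G u)))
                       (cong (λ b → deg G u * indicator b) (==-refl u)) ⟩
        deg G u * 1
          ≡⟨ *-identityʳ (deg G u) ⟩
        deg G u ∎)
      by-cases (no v≢u) = begin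
        deg G v
          ≡⟨ deg-isolate-other v≢u ⟩
        indicator (adj G v u) + deg (isolate G u) v
          ≡⟨ rearrange (indicator (adj G v u)) (deg (isolate G u) v) (deg G u) ⟩
        deg (isolate G u) v + indicator (adj G v u) + deg G u * 0
          ≡⟨ cong (λ b → deg (isolate G u) v + indicator (adj G v u) + deg G u * indicator b) (==-≢ v≢u) ⟨
        deg (isolate G u) v + indicator (adj G v u) + deg G u * indicator (v == u) ∎

    degree-sum-isolate : sumℕ (deg G) ≡ sumℕ (deg (isolate G u)) + 2 * deg G u
    degree-sum-isolate = begin
      sumℕ (deg G)
        ≡⟨ sumℕ-cong deg-isolate ⟩
      sumℕ (λ v → deg G' v + indicator (adj G v u) + deg G u * indicator (v == u))
        ≡⟨ trans (sumℕ-+ (λ v → deg G' v + indicator (adj G v u)) pointMass)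
                 (cong (_+ sumℕ pointMass) (sumℕ-+ (deg G') (λ v → indicator (adj G v u)))) ⟩
      sumℕ (deg G') + count (λ v → adj G v u) + sumℕ (λ v → deg G u * indicator (v == u))
        ≡⟨ cong₂ (λ a b → sumℕ (deg G') + a + b) (count-cong (λ v → Graph.sym G v u))
                                                 (sumℕ-*ˡ (deg G u) (λ v → indicator (v == u))) ⟩
      sumℕ (deg G') + deg G u + deg G u * count (_== u)
        ≡⟨ cong (λ c → sumℕ (deg G') + deg G u + deg G u * c) (count-== (λ _ → true) u) ⟩
      sumℕ (deg G') + deg G u + deg G u * 1
        ≡⟨ double (sumℕ (deg G')) (deg G u) ⟩
      sumℕ (deg G') + 2 * deg G u ∎
      where
      open ≡-Reasoning
      G' = isolate G u
      pointMass : Fin n → ℕ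
      pointMass v = deg G u * indicator (v == u)
      double : ∀ a d → a + d + d * 1 ≡ a + 2 * d
      double = solve-∀

    degree-sum-isolate-leaf : deg G u ≡ 1 → sumℕ (deg G) ≡ sumℕ (deg (isolate G u)) + 2
    degree-sum-isolate-leaf deg-u = trans degree-sum-isolate (cong (λ d → sumℕ (deg (isolate G u)) + 2 * d) deg-u)

  nonIsolated : Graph n → Fin n → Bool
  nonIsolated G v = not (isIsolated G v)

  module _ {n : ℕ} (G : Graph n) where

    deg≥1⇒nonIsolated : ∀ {v} → 1 ≤ deg G v → nonIsolated G v ≡ true
    deg≥1⇒nonIsolated {v} 1≤deg with deg G v | 1≤deg
    ... | suc _ | _ = refl

    nonIsolated⇒deg≥1 : ∀ {v} → nonIsolated G v ≡ true → 1 ≤ deg G v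
    nonIsolated⇒deg≥1 {v} nonIso with deg G v | nonIso
    ... | suc _ | _ = s≤s z≤n

    -- |E| ≤ #(non-isolated vertices) − 1 for a forest with an edge: unlike |E| ≤ n − 1, this survives
    -- deleting the edge at a leaf, which isolates the leaf.
    ForestDegreeBound : Set
    ForestDegreeBound = sumℕ (deg G) ≡ 0 ⊎ sumℕ (deg G) + 2 ≤ 2 * count (nonIsolated G)

  module _ {n : ℕ} (G : Graph n) {u w : Fin n} (deg-u : deg G u ≡ 1) (uw : adj G u w ≡ true) where
    private
      G′ = isolate G u

      sum≡ : sumℕ (deg G) ≡ sumℕ (deg G′) + 2
      sum≡ = degree-sum-isolate-leaf G u deg-u

      u-nonIsolated : nonIsolated G u ≡ true
      u-nonIsolated = deg≥1⇒nonIsolated G (≤-reflexive (sym deg-u))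

      u-isolated′ : nonIsolated G′ u ≡ false
      u-isolated′ = cong (λ d → not (d ≡ᵇ 0)) (deg-isolate-self G u)

      fewer-nonIsolated : suc (count (nonIsolated G′)) ≤ count (nonIsolated G)
      fewer-nonIsolated = count-strict (nonIsolated G′) (nonIsolated G)
        (λ v nonIsolated′ → deg≥1⇒nonIsolated G
           (≤-trans (nonIsolated⇒deg≥1 G′ nonIsolated′) (deg-isolate-≤ G u v)))
        u u-isolated′ u-nonIsolated

      two-nonIsolated : 2 ≤ count (nonIsolated G)
      two-nonIsolated = count-≥2 (nonIsolated G) u-nonIsolated
        (deg≥1⇒nonIsolated G (Adj⇒deg≥1 G (Adj-sym G (≡⇒T uw))))
        (Adj-irrefl G (≡⇒T uw))

    leaf-removal-bound : ForestDegreeBound G′ → sumℕ (deg G) + 2 ≤ 2 * count (nonIsolated G)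
    leaf-removal-bound (inj₁ no-edges′) = begin
      sumℕ (deg G) + 2           ≡⟨ cong (_+ 2) (trans sum≡ (cong (_+ 2) no-edges′)) ⟩
      2 * 2                      ≤⟨ *-monoʳ-≤ 2 two-nonIsolated ⟩
      2 * count (nonIsolated G)  ∎
      where open ≤-Reasoning
    leaf-removal-bound (inj₂ bound′) = begin
      sumℕ (deg G) + 2                  ≡⟨ cong (_+ 2) sum≡ ⟩
      sumℕ (deg G′) + 2 + 2             ≤⟨ +-monoˡ-≤ 2 bound′ ⟩
      2 * count (nonIsolated G′) + 2    ≡⟨ trans (+-comm _ 2) (sym (*-suc 2 _)) ⟩
      2 * suc (count (nonIsolated G′))  ≤⟨ *-monoʳ-≤ 2 fewer-nonIsolated ⟩
      2 * count (nonIsolated G)         ∎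
      where open ≤-Reasoning

  module _ {n : ℕ} where

    forest-degree-bound : (G : Graph n) → Acyclic G → ForestDegreeBound G
    forest-degree-bound G acyclic = go G acyclic (<-wellFounded _)
      where
      go : (G : Graph n) → Acyclic G → Acc _<_ (sumℕ (deg G)) → ForestDegreeBound G
      go G acyclic (acc smaller) with any? (λ a → any? (λ b → T? (adj G a b)))
      ... | no edgeless =
        inj₁ (sumℕ-zero (λ a → count-none (adj G a) (λ b → ¬-not (λ ab → edgeless (a , b , ≡⇒T ab)))))
      ... | yes (_ , _ , ab) with leaf-exists G acyclic ab
      ... | u , deg-u with count-witness (adj G u) (≤-reflexive (sym deg-u))
      ... | w , uw = inj₂ (leaf-removal-bound G deg-u uw
                       (go (isolate G u) (isolate-acyclic G u acyclic)
                           (smaller (<-≤-trans (m<m+n _ (s≤s z≤n))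
                                               (≤-reflexive (sym (degree-sum-isolate-leaf G u deg-u)))))))

    tree-degree-sum : 1 ≤ n → (G : Graph n) → Acyclic G → sumℕ (deg G) + 2 ≤ 2 * n
    tree-degree-sum 1≤n G acyclic with forest-degree-bound G acyclic
    ... | inj₁ no-edges rewrite no-edges = *-monoʳ-≤ 2 1≤n
    ... | inj₂ bound    = ≤-trans bound (*-monoʳ-≤ 2 (count-≤ (nonIsolated G)))

  -- Signed dominating functions

  -- The sign function of Defs is parametrised by a graph it does not use.
  signedSum : ∀ {m} → Graph m → (Fin n → Bool) → (Fin n → Bool) → ℤ
  signedSum G a b = sumℤ (λ u → if a u then sign G (b u) else + 0)

  signed-count : ∀ {m} (G : Graph m) (a b : Fin n → Bool) →
                 signedSum G a b ℤ.+ + count (λ u → a u ∧ not (b u)) ≡ + count (λ u → a u ∧ b u)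
  signed-count {zero}  G a b = refl
  signed-count {suc n} G a b = step (a zero) (b zero) (signed-count G (tail a) (tail b))
    where
    step : ∀ x y {s m c} → s ℤ.+ + m ≡ + c →
           ((if x then sign G y else + 0) ℤ.+ s) ℤ.+ + (indicator (x ∧ not y) + m) ≡ + (indicator (x ∧ y) + c)
    step true  true  {s} {m} rest = trans (ℤ.+-assoc (+ 1) s (+ m)) (cong (ℤ._+_ (+ 1)) rest)
    step true  false {s} {m} rest = trans (cancel s (+ m)) rest
      where
      cancel : ∀ s c → (-[1+ 0 ] ℤ.+ s) ℤ.+ (+ 1 ℤ.+ c) ≡ s ℤ.+ c
      cancel = ℤ-Solver.solve-∀
    step false _     {s} {m} rest = trans (cong (ℤ._+ + m) (ℤ.+-identityˡ s)) rest

  suc-⌈/2⌉-≤ : ∀ {δ a} → 2 + δ ≤ a + a → suc ⌈ δ /2⌉ ≤ a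
  suc-⌈/2⌉-≤ {a = a} 2+δ≤2a = ≤-trans (⌈n/2⌉-mono 2+δ≤2a) (≤-reflexive (sym (n≡⌈n+n/2⌉ a)))

  inC-intro : (G : Graph n) {v : Fin n} → 2 ≤ deg G v → isSupport G v ≡ false → T (inC G v)
  inC-intro G {v} 2≤deg not-support with deg G v | 2≤deg
  ... | suc (suc _) | _ rewrite not-support = _
  ... | suc zero    | s≤s ()

  module _ {n : ℕ} (G : Graph n) (f : Fin n → Bool) where

    plusNbrs minusNbrs : Fin n → ℕ
    plusNbrs  v = count (λ u → adj G v u ∧ f u)
    minusNbrs v = count (λ u → adj G v u ∧ not (f u))

    deg≡plus+minus : ∀ v → deg G v ≡ plusNbrs v + minusNbrs v
    deg≡plus+minus v = count-split (adj G v) f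

    plus≤deg : ∀ v → plusNbrs v ≤ deg G v
    plus≤deg v = ≤-trans (m≤m+n _ _) (≤-reflexive (sym (deg≡plus+minus v)))

    module _ (sdf : IsSDF G f) where

      sdf-balance : ∀ v → + 1 ℤ.+ + minusNbrs v ℤ.≤ sign G (f v) ℤ.+ + plusNbrs v
      sdf-balance v = ℤ.≤-trans (ℤ.+-monoˡ-≤ (+ minusNbrs v) (sdf v))
                           (ℤ.≤-reflexive (trans (ℤ.+-assoc (sign G (f v)) _ _)
                                                 (cong (ℤ._+_ (sign G (f v))) (signed-count G (adj G v) f))))

      positive-balance : ∀ {v} → f v ≡ true → minusNbrs v ≤ plusNbrs v
      positive-balance {v} fv with sdf-balance v
      ... | ineq rewrite fv = ≤-pred (ℤ.drop‿+≤+ ineq)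

      negative-balance : ∀ {v} → f v ≡ false → 2 + minusNbrs v ≤ plusNbrs v
      negative-balance {v} fv with sdf-balance v
      ... | ineq rewrite fv = ≤-trans (≤-reflexive (cong suc (+-comm 1 (minusNbrs v))))
                                     (ℤ.drop‿+≤+ (ℤ.≤-trans (ℤ.+-monoˡ-≤ (+ 1) ineq) (ℤ.≤-reflexive (cancel _))))
        where
        cancel : ∀ p → (-[1+ 0 ] ℤ.+ p) ℤ.+ + 1 ≡ p
        cancel = ℤ-Solver.solve-∀

      leaf-positive : ∀ {x} → isLeaf G x ≡ true → f x ≡ true
      leaf-positive {x} leaf = ¬-not λ fx → 1+n≰n (begin
        2                      ≤⟨ m≤m+n 2 (minusNbrs x) ⟩
        2 + minusNbrs x        ≤⟨ negative-balance fx ⟩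
        plusNbrs x             ≤⟨ plus≤deg x ⟩
        deg G x                ≡⟨ isLeaf⇒deg≡1 G leaf ⟩
        1                      ∎)
        where open ≤-Reasoning

      leaf-neighbour-positive : ∀ {x y} → isLeaf G x ≡ true → adj G x y ≡ true → f y ≡ true
      leaf-neighbour-positive {x} {y} leaf xy = ¬-not λ fy → 1+n≰n (begin
        2                           ≤⟨ +-mono-≤ (≤-trans (minus≥1 fy) (positive-balance (leaf-positive leaf)))
                                                (minus≥1 fy) ⟩
        plusNbrs x + minusNbrs x    ≡⟨ deg≡plus+minus x ⟨
        deg G x                     ≡⟨ isLeaf⇒deg≡1 G leaf ⟩
        1                           ∎)
        where
        open ≤-Reasoning
        minus≥1 : f y ≡ false → 1 ≤ minusNbrs x
        minus≥1 fy = count-≥1 _ y (cong₂ _∧_ xy (cong not fy))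

      support-positive : ∀ {v} → isSupport G v ≡ true → f v ≡ true
      support-positive {v} support with anyFin-witness (λ u → adj G v u ∧ isLeaf G u) support
      ... | x , vx-leaf = leaf-neighbour-positive (∧-trueʳ vx-leaf) (trans (Graph.sym G x v) (∧-trueˡ vx-leaf))

      negative∈C : ∀ {v} → f v ≡ false → T (inC G v)
      negative∈C {v} fv = inC-intro G (≤-trans (≤-trans (m≤m+n 2 _) (negative-balance fv)) (plus≤deg v))
                                      (¬-not λ support → case trans (sym (support-positive support)) fv of λ ())

      positive⇒plusNbr : ∀ {v} → 1 ≤ deg G v → f v ≡ true → 1 ≤ plusNbrs v
      positive⇒plusNbr {v} 1≤deg fv with plusNbrs v in plus≡
      ... | suc _ = s≤s z≤n
      ... | zero  = ≤-trans 1≤deg (begin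
        deg G v                   ≡⟨ deg≡plus+minus v ⟩
        plusNbrs v + minusNbrs v  ≤⟨ +-monoʳ-≤ (plusNbrs v) (positive-balance fv) ⟩
        plusNbrs v + plusNbrs v   ≡⟨ cong₂ _+_ plus≡ plus≡ ⟩
        0                         ∎)
        where open ≤-Reasoning

      negative⇒plusNbrs : ∀ {δ v} → (∀ v → T (inC G v) → δ ≤ deg G v) → f v ≡ false → suc ⌈ δ /2⌉ ≤ plusNbrs v
      negative⇒plusNbrs {δ} {v} δ≤deg fv = suc-⌈/2⌉-≤ (begin
        2 + δ                              ≤⟨ +-monoʳ-≤ 2 (δ≤deg v (negative∈C fv)) ⟩
        2 + deg G v                        ≡⟨ cong (_+_ 2) (deg≡plus+minus v) ⟩
        2 + (plusNbrs v + minusNbrs v)     ≡⟨ swap 2 (plusNbrs v) (minusNbrs v) ⟩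
        plusNbrs v + (2 + minusNbrs v)     ≤⟨ +-monoʳ-≤ (plusNbrs v) (negative-balance fv) ⟩
        plusNbrs v + plusNbrs v            ∎)
        where
        open ≤-Reasoning
        swap : ∀ a b c → a + (b + c) ≡ b + (a + c)
        swap = solve-∀

  -- Counting edges

  module _ {n : ℕ} (G : Graph n) where

    edgesBetween : (Fin n → Bool) → (Fin n → Bool) → ℕ
    edgesBetween a b = sumℕ (λ v → count (λ u → adj G v u ∧ (a v ∧ b u)))

    edgesBetween-comm : ∀ a b → edgesBetween a b ≡ edgesBetween b a
    edgesBetween-comm a b = trans (sumℕ-comm (λ v u → indicator (adj G v u ∧ (a v ∧ b u))))
      (sumℕ-cong λ u → count-cong λ v → cong₂ _∧_ (Graph.sym G v u) (∧-comm (a v) (b u)))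

    edgesBetween-≤-degree-sum : (a : Fin n → Bool) →
      edgesBetween a a + edgesBetween a (not ∘ a) + edgesBetween (not ∘ a) a ≤ sumℕ (deg G)
    edgesBetween-≤-degree-sum a = begin
      edgesBetween a a + edgesBetween a (not ∘ a) + edgesBetween (not ∘ a) a
        ≡⟨ cong (_+ edgesBetween (not ∘ a) a) (sumℕ-+ (λ v → count (λ u → adj G v u ∧ (a v ∧ a u)))
                                                      (λ v → count (λ u → adj G v u ∧ (a v ∧ not (a u))))) ⟨
      sumℕ (λ v → count (λ u → adj G v u ∧ (a v ∧ a u)) + count (λ u → adj G v u ∧ (a v ∧ not (a u))))
        + edgesBetween (not ∘ a) a
        ≡⟨ sumℕ-+ _ (λ v → count (λ u → adj G v u ∧ (not (a v) ∧ a u))) ⟨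
      sumℕ (λ v → count (λ u → adj G v u ∧ (a v ∧ a u)) + count (λ u → adj G v u ∧ (a v ∧ not (a u)))
                  + count (λ u → adj G v u ∧ (not (a v) ∧ a u)))
        ≤⟨ sumℕ-mono pointwise ⟩
      sumℕ (deg G) ∎
      where
      open ≤-Reasoning
      pointwise : ∀ v → count (λ u → adj G v u ∧ (a v ∧ a u)) + count (λ u → adj G v u ∧ (a v ∧ not (a u)))
                        + count (λ u → adj G v u ∧ (not (a v) ∧ a u)) ≤ deg G v
      pointwise v with a v
      ... | true  = ≤-reflexive (trans (cong (_+_ _) (count-∧-false (adj G v)))
                                       (trans (+-identityʳ _) (sym (count-split (adj G v) a))))
      ... | false = ≤-trans (≤-reflexive (cong₂ (λ x y → x + y + count (λ u → adj G v u ∧ a u))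
                                                (count-∧-false (adj G v)) (count-∧-false (adj G v))))
                            (count-mono (λ u → adj G v u ∧ a u) (adj G v) (λ u → ∧-trueˡ))

    leafNbrs : Fin n → ℕ
    leafNbrs v = count (λ u → adj G v u ∧ isLeaf G u)

    sum-leafNbrs : sumℕ leafNbrs ≡ numLeaves G
    sum-leafNbrs = trans (edgesBetween-comm (λ _ → true) (isLeaf G)) (sumℕ-cong pointwise)
      where
      pointwise : ∀ v → count (λ u → adj G v u ∧ (isLeaf G v ∧ true)) ≡ indicator (isLeaf G v)
      pointwise v with isLeaf G v in leaf
      ... | true  = trans (count-cong (λ u → ∧-identityʳ (adj G v u))) (isLeaf⇒deg≡1 G leaf)
      ... | false = count-∧-false (adj G v)

  module _ {n : ℕ} (G : Graph n) (f : Fin n → Bool) (sdf : IsSDF G f) where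

    edgesBetween-plus-plus : (∀ v → 1 ≤ deg G v) → count f + numLeaves G ≤ edgesBetween G f f + numSupports G
    edgesBetween-plus-plus deg≥1 = begin
      count f + numLeaves G
        ≡⟨ cong (_+_ (count f)) (sum-leafNbrs G) ⟨
      count f + sumℕ (leafNbrs G)
        ≡⟨ sumℕ-+ (indicator ∘ f) (leafNbrs G) ⟨
      sumℕ (λ v → indicator (f v) + leafNbrs G v)
        ≤⟨ sumℕ-mono pointwise ⟩
      sumℕ (λ v → count (λ u → adj G v u ∧ (f v ∧ f u)) + indicator (isSupport G v))
        ≡⟨ sumℕ-+ (λ v → count (λ u → adj G v u ∧ (f v ∧ f u))) (indicator ∘ isSupport G) ⟩
      edgesBetween G f f + numSupports G ∎
      where
      open ≤-Reasoning
      leafNbrs≤plusNbrs : ∀ v → leafNbrs G v ≤ plusNbrs G f v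
      leafNbrs≤plusNbrs v = count-mono (λ u → adj G v u ∧ isLeaf G u) (λ u → adj G v u ∧ f u) λ u vu-leaf →
        cong₂ _∧_ (∧-trueˡ vu-leaf) (leaf-positive G f sdf (∧-trueʳ vu-leaf))
      no-leafNbrs : ∀ {v} → isSupport G v ≡ false → leafNbrs G v ≡ 0
      no-leafNbrs {v} not-support =
        count-none (λ u → adj G v u ∧ isLeaf G u) (anyFin-none (λ u → adj G v u ∧ isLeaf G u) not-support)
      pointwise : ∀ v → indicator (f v) + leafNbrs G v
                        ≤ count (λ u → adj G v u ∧ (f v ∧ f u)) + indicator (isSupport G v)
      pointwise v with f v in fv | isSupport G v in support
      ... | true  | true  = ≤-trans (≤-reflexive (+-comm 1 (leafNbrs G v))) (+-monoˡ-≤ 1 (leafNbrs≤plusNbrs v))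
      ... | true  | false = begin
        1 + leafNbrs G v   ≡⟨ cong (_+_ 1) (no-leafNbrs support) ⟩
        1                  ≤⟨ positive⇒plusNbr G f sdf (deg≥1 v) fv ⟩
        plusNbrs G f v     ≡⟨ +-identityʳ (plusNbrs G f v) ⟨
        plusNbrs G f v + 0 ∎
      ... | false | true  = case trans (sym (support-positive G f sdf support)) fv of λ ()
      ... | false | false =
        ≤-reflexive (trans (no-leafNbrs support) (sym (trans (+-identityʳ _) (count-∧-false (adj G v)))))

    edgesBetween-minus-plus : ∀ δ → (∀ v → T (inC G v) → δ ≤ deg G v) →
                    suc ⌈ δ /2⌉ * count (not ∘ f) ≤ edgesBetween G (not ∘ f) f
    edgesBetween-minus-plus δ δ≤deg = begin
      suc ⌈ δ /2⌉ * count (not ∘ f)                    ≡⟨ sumℕ-*ˡ (suc ⌈ δ /2⌉) (indicator ∘ not ∘ f) ⟨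
      sumℕ (λ v → suc ⌈ δ /2⌉ * indicator (not (f v)))  ≤⟨ sumℕ-mono pointwise ⟩
      edgesBetween G (not ∘ f) f                       ∎
      where
      open ≤-Reasoning
      pointwise : ∀ v → suc ⌈ δ /2⌉ * indicator (not (f v)) ≤ count (λ u → adj G v u ∧ (not (f v) ∧ f u))
      pointwise v with f v in fv
      ... | true  = ≤-trans (≤-reflexive (*-zeroʳ (suc ⌈ δ /2⌉))) z≤n
      ... | false = ≤-trans (≤-reflexive (*-identityʳ (suc ⌈ δ /2⌉))) (negative⇒plusNbrs G f sdf δ≤deg fv)

    counting-inequality : (∀ v → 1 ≤ deg G v) → sumℕ (deg G) + 2 ≤ 2 * n →
                     ∀ δ → (∀ v → T (inC G v) → δ ≤ deg G v) →
                     numLeaves G + 2 + 2 * ⌈ δ /2⌉ * count (not ∘ f) ≤ count f + numSupports G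
    counting-inequality deg≥1 few-edges δ δ≤deg = +-cancelʳ-≤ (p + 2 * m) (ℓ + 2 + 2 * K * m) (p + s) (begin
      (ℓ + 2 + 2 * K * m) + (p + 2 * m)        ≡⟨ regroup ℓ K m p ⟩
      (p + ℓ) + suc K * m + suc K * m + 2      ≤⟨ +-monoˡ-≤ 2 (+-mono-≤ (+-mono-≤ (edgesBetween-plus-plus deg≥1) to-plus)
                                                                    (edgesBetween-minus-plus δ δ≤deg)) ⟩
      (E₊₊ + s) + E₊₋ + E₋₊ + 2                ≡⟨ move-s E₊₊ s E₊₋ E₋₊ ⟩
      (E₊₊ + E₊₋ + E₋₊ + 2) + s                ≤⟨ +-monoˡ-≤ s (+-monoˡ-≤ 2 (edgesBetween-≤-degree-sum G f)) ⟩
      (sumℕ (deg G) + 2) + s                   ≤⟨ +-monoˡ-≤ s few-edges ⟩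
      2 * n + s                                ≡⟨ cong (λ k → 2 * k + s) n≡p+m ⟩
      2 * (p + m) + s                          ≡⟨ spread p m s ⟩
      (p + s) + (p + 2 * m)                    ∎)
      where
      open ≤-Reasoning
      p m ℓ s K E₊₊ E₊₋ E₋₊ : ℕ
      p = count f
      m = count (not ∘ f)
      ℓ = numLeaves G
      s = numSupports G
      K = ⌈ δ /2⌉
      E₊₊ = edgesBetween G f f
      E₊₋ = edgesBetween G f (not ∘ f)
      E₋₊ = edgesBetween G (not ∘ f) f
      to-plus : suc K * m ≤ E₊₋
      to-plus = ≤-trans (edgesBetween-minus-plus δ δ≤deg) (≤-reflexive (edgesBetween-comm G (not ∘ f) f))
      n≡p+m : n ≡ p + m
      n≡p+m = sym (count-+-count-not f)
      regroup : ∀ ℓ K m p → (ℓ + 2 + 2 * K * m) + (p + 2 * m) ≡ (p + ℓ) + suc K * m + suc K * m + 2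
      regroup = solve-∀
      move-s : ∀ a s b c → (a + s) + b + c + 2 ≡ (a + b + c + 2) + s
      move-s = solve-∀
      spread : ∀ p m s → 2 * (p + m) + s ≡ (p + s) + (p + 2 * m)
      spread = solve-∀

  bound-from-counts : ∀ δ {p m ℓ s} (w : ℤ) → w ℤ.+ + m ≡ + p → ℓ + 2 + 2 * ⌈ δ /2⌉ * m ≤ p + s →
                      boundNumerator (p + m) δ ℓ s ℤ.≤ + boundDenominator δ ℤ.* w
  bound-from-counts δ {p} {m} {ℓ} {s} w w+m≡p counts
    with d , counts+d≡ ← m≤n⇒∃[o]m+o≡n counts =
    ℤ.≤-trans (ℤ.i≤i+j (boundNumerator (p + m) δ ℓ s) (+ (2 * d))) (ℤ.≤-reflexive (sym (begin
      + boundDenominator δ ℤ.* w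
        ≡⟨ cong (ℤ._* w) (ℤ.pos-+ (2 * K) 1) ⟩
      (+ (2 * K) ℤ.+ + 1) ℤ.* w
        ≡⟨ identity (+ (2 * K)) w (+ m) (+ ℓ) (+ s) ⟩
      (+ (2 * K) ℤ.- + 1) ℤ.* ((w ℤ.+ + m) ℤ.+ + m) ℤ.+ + 2 ℤ.* ((+ ℓ ℤ.- + s) ℤ.+ + 2)
        ℤ.+ + 2 ℤ.* (((w ℤ.+ + m) ℤ.+ + s) ℤ.- ((+ ℓ ℤ.+ + 2) ℤ.+ + (2 * K) ℤ.* + m))
        ≡⟨ cong₂ (λ x y → (+ (2 * K) ℤ.- + 1) ℤ.* (x ℤ.+ + m) ℤ.+ + 2 ℤ.* ((+ ℓ ℤ.- + s) ℤ.+ + 2) ℤ.+ + 2 ℤ.* y)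
                 w+m≡p excess ⟩
      (+ (2 * K) ℤ.- + 1) ℤ.* (+ p ℤ.+ + m) ℤ.+ + 2 ℤ.* ((+ ℓ ℤ.- + s) ℤ.+ + 2) ℤ.+ + 2 ℤ.* + d
        ≡⟨ cong₂ (λ x y → (+ (2 * K) ℤ.- + 1) ℤ.* x ℤ.+ + 2 ℤ.* ((+ ℓ ℤ.- + s) ℤ.+ + 2) ℤ.+ y)
                 (sym (ℤ.pos-+ p m)) (sym (ℤ.pos-* 2 d)) ⟩
      boundNumerator (p + m) δ ℓ s ℤ.+ + (2 * d) ∎)))
    where
    open ≡-Reasoning
    K = ⌈ δ /2⌉
    identity : ∀ t w m l s → (t ℤ.+ + 1) ℤ.* w ≡
               (t ℤ.- + 1) ℤ.* ((w ℤ.+ m) ℤ.+ m) ℤ.+ + 2 ℤ.* ((l ℤ.- s) ℤ.+ + 2)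
               ℤ.+ + 2 ℤ.* (((w ℤ.+ m) ℤ.+ s) ℤ.- ((l ℤ.+ + 2) ℤ.+ t ℤ.* m))
    identity = ℤ-Solver.solve-∀
    cancel : ∀ x e → (x ℤ.+ e) ℤ.- x ≡ e
    cancel = ℤ-Solver.solve-∀
    excess : ((w ℤ.+ + m) ℤ.+ + s) ℤ.- ((+ ℓ ℤ.+ + 2) ℤ.+ + (2 * K) ℤ.* + m) ≡ + d
    excess = begin
      ((w ℤ.+ + m) ℤ.+ + s) ℤ.- ((+ ℓ ℤ.+ + 2) ℤ.+ + (2 * K) ℤ.* + m)
        ≡⟨ cong₂ (λ x y → (x ℤ.+ + s) ℤ.- y) w+m≡p
                 (trans (cong₂ ℤ._+_ (sym (ℤ.pos-+ ℓ 2)) (sym (ℤ.pos-* (2 * K) m))) (sym (ℤ.pos-+ (ℓ + 2) (2 * K * m)))) ⟩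
      (+ p ℤ.+ + s) ℤ.- + (ℓ + 2 + 2 * K * m)
        ≡⟨ cong (ℤ._- + (ℓ + 2 + 2 * K * m)) (trans (sym (ℤ.pos-+ p s)) (trans (cong +_ (sym counts+d≡)) (ℤ.pos-+ _ d))) ⟩
      (+ (ℓ + 2 + 2 * K * m) ℤ.+ + d) ℤ.- + (ℓ + 2 + 2 * K * m)
        ≡⟨ cancel (+ (ℓ + 2 + 2 * K * m)) (+ d) ⟩
      + d ∎

  sdf-weight-bound : (G : Graph n) → (∀ v → 1 ≤ deg G v) → sumℕ (deg G) + 2 ≤ 2 * n →
                     ∀ δ → (∀ v → T (inC G v) → δ ≤ deg G v) → ∀ f → IsSDF G f →
                     boundNumerator n δ (numLeaves G) (numSupports G) ℤ.≤ + boundDenominator δ ℤ.* weight G f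
  sdf-weight-bound G deg≥1 few-edges δ δ≤deg f sdf =
    subst (λ k → boundNumerator k δ (numLeaves G) (numSupports G) ℤ.≤ + boundDenominator δ ℤ.* weight G f)
          (count-+-count-not f)
          (bound-from-counts δ (weight G f) (signed-count G (λ _ → true) f)
                             (counting-inequality G f sdf deg≥1 few-edges δ δ≤deg))

  tree-sdf-weight-bound : (G : Graph n) → 2 ≤ n → IsTree G →
                          ∀ δ → (∀ v → T (inC G v) → δ ≤ deg G v) → ∀ f → IsSDF G f →
                          boundNumerator n δ (numLeaves G) (numSupports G) ℤ.≤ + boundDenominator δ ℤ.* weight G f
  tree-sdf-weight-bound G 2≤n (connected , acyclic) =
    sdf-weight-bound G (connected⇒deg≥1 G 2≤n connected) (tree-degree-sum (≤-trans (s≤s z≤n) 2≤n) G acyclic)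

  Unique-∷ʳ : ∀ {a} {A : Set a} {x : A} {ys} → All (λ y → ¬ x ≡ y) ys → Unique ys → Unique (ys ∷ʳ x)
  Unique-∷ʳ []          []             = [] ∷ []
  Unique-∷ʳ (x≢y ∷ x∉) (y∉ ∷ unique) = Allₚ.∷ʳ⁺ y∉ (x≢y ∘ sym) ∷ Unique-∷ʳ x∉ unique

  private
    climbed-too-far : ∀ {a b c} → suc b ≡ c → c < a → ¬ (suc a ≡ b ⊎ suc b ≡ a)
    climbed-too-far refl c<a (inj₁ refl) = 1+n≰n (≤-trans (m≤n+m _ 2) c<a)
    climbed-too-far refl c<a (inj₂ refl) = <-irrefl refl c<a

    descended-too-far : ∀ {a b c} → suc c ≡ b → a < c → ¬ (suc a ≡ b ⊎ suc b ≡ a)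
    descended-too-far refl a<c (inj₁ a+1≡c+1) = <-irrefl (suc-injective a+1≡c+1) a<c
    descended-too-far refl a<c (inj₂ refl)    = 1+n≰n (≤-trans (m≤n+m _ 2) a<c)

  path : (n : ℕ) → Graph n
  path n = record
    { adj    = λ i j → (suc (toℕ i) ≡ᵇ toℕ j) ∨ (suc (toℕ j) ≡ᵇ toℕ i)
    ; sym    = λ i j → ∨-comm (suc (toℕ i) ≡ᵇ toℕ j) (suc (toℕ j) ≡ᵇ toℕ i)
    ; irrefl = λ i → cong₂ _∨_ (suc≢ᵇ (toℕ i)) (suc≢ᵇ (toℕ i))
    }
    where
    suc≢ᵇ : ∀ k → (suc k ≡ᵇ k) ≡ false
    suc≢ᵇ zero    = refl
    suc≢ᵇ (suc k) = suc≢ᵇ k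

  module _ {n : ℕ} where

    private
      _↗_ : Fin n → Fin n → Set
      i ↗ j = suc (toℕ i) ≡ toℕ j

    path-step : ∀ i j → Adj (path n) i j → i ↗ j ⊎ j ↗ i
    path-step i j ij with Equivalence.to T-∨ ij
    ... | inj₁ up   = inj₁ (≡ᵇ⇒≡ _ _ up)
    ... | inj₂ down = inj₂ (≡ᵇ⇒≡ _ _ down)

    ascending : ∀ {a b cs} → Linked (Adj (path n)) (a ∷ b ∷ cs) → Unique (a ∷ b ∷ cs) → a ↗ b →
                All (λ c → toℕ b < toℕ c) cs
    ascending {cs = []}    _              _                  _   = []
    ascending {b = b} {c ∷ _} (_ ∷ bc ∷ rest) ((_ ∷ a≢c ∷ _) ∷ unique) a↗b with path-step b c bc
    ... | inj₁ b↗c = ≤-reflexive b↗c ∷ All.map (<-trans (≤-reflexive b↗c)) (ascending (bc ∷ rest) unique b↗c)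
    ... | inj₂ c↗b = ⊥-elim (a≢c (toℕ-injective (suc-injective (trans a↗b (sym c↗b)))))

    descending : ∀ {a b cs} → Linked (Adj (path n)) (a ∷ b ∷ cs) → Unique (a ∷ b ∷ cs) → b ↗ a →
                 All (λ c → toℕ c < toℕ b) cs
    descending {cs = []}    _              _                  _   = []
    descending {b = b} {c ∷ _} (_ ∷ bc ∷ rest) ((_ ∷ a≢c ∷ _) ∷ unique) b↗a with path-step b c bc
    ... | inj₁ b↗c = ⊥-elim (a≢c (toℕ-injective (trans (sym b↗a) b↗c)))
    ... | inj₂ c↗b = ≤-reflexive c↗b ∷ All.map (λ d<c → <-trans d<c (≤-reflexive c↗b)) (descending (bc ∷ rest) unique c↗b)

    -- A repetition-free walk in a path is monotone, so it cannot end next to its start.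
    path-acyclic : Acyclic (path n)
    path-acyclic (_ , []          , () , _)
    path-acyclic (_ , _ ∷ []      , s≤s () , _)
    path-acyclic (x , y₁ ∷ y₂ ∷ zs , _ , x∉ ∷ unique , xy₁ ∷ walk) =
      monotone (path-step y₁ y₂ (Linked.head walk)) (path-step x y₁ xy₁)
      where
      unique′ = Unique-∷ʳ x∉ unique
      x∈ = ∈-++⁺ʳ zs (here refl)
      monotone : y₁ ↗ y₂ ⊎ y₂ ↗ y₁ → ¬ (x ↗ y₁ ⊎ y₁ ↗ x)
      monotone (inj₁ up)   = climbed-too-far up (All.lookup (ascending walk unique′ up) x∈)
      monotone (inj₂ down) = descended-too-far down (All.lookup (descending walk unique′ down) x∈)

  -- Sharpness: the path on five vertices

  P₅ : Graph 5
  P₅ = path 5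

  P₅-connected : Connected P₅
  P₅-connected = connected-via P₅ 0F to-0F
    where
    to-0F : ∀ v → Walk P₅ v 0F
    to-0F 0F = []
    to-0F 1F = _ ∷ []
    to-0F 2F = _∷_ {w = 1F} _ (_ ∷ [])
    to-0F 3F = _∷_ {w = 2F} _ (_∷_ {w = 1F} _ (_ ∷ []))
    to-0F 4F = _∷_ {w = 3F} _ (_∷_ {w = 2F} _ (_∷_ {w = 1F} _ (_ ∷ [])))

  P₅-δ* : IsDeltaStar P₅ 2
  P₅-δ* = (2F , _ , refl) , centre-only
    where
    centre-only : ∀ v → T (inC P₅ v) → 2 ≤ deg P₅ v
    centre-only 2F _ = ≤-refl
    centre-only 0F ()
    centre-only 1F ()
    centre-only 3F ()
    centre-only 4F ()

  -- Minimality of the witness is the lower bound itself: 3 γₛ ≥ 9.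
  P₅-γₛ : IsSignedDomNumber P₅ (+ 3)
  P₅-γₛ = (minus-centre , dominating , refl) , λ f sdf →
    ℤ.*-cancelˡ-≤-pos (+ 3) (weight P₅ f) (+ 3)
      (tree-sdf-weight-bound P₅ (s≤s (s≤s z≤n)) (P₅-connected , path-acyclic) 2 (proj₂ P₅-δ*) f sdf)
    where
    minus-centre : Fin 5 → Bool
    minus-centre v = not (v == 2F)
    dominating : IsSDF P₅ minus-centre
    dominating 0F = ℤ.+≤+ (s≤s z≤n)
    dominating 1F = ℤ.+≤+ (s≤s z≤n)
    dominating 2F = ℤ.+≤+ (s≤s z≤n)
    dominating 3F = ℤ.+≤+ (s≤s z≤n)
    dominating 4F = ℤ.+≤+ (s≤s z≤n)

open import Defs
open import Data.Nat using (ℕ; z≤n; s≤s)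
open import Data.Integer using (ℤ; +_; _*_)
open import Data.Product using (Σ; _×_; _,_)
open import Data.Fin.Patterns using (2F)
open import Relation.Binary.PropositionalEquality using (_≡_; refl)
open SignedDomination using (tree-sdf-weight-bound; P₅; P₅-connected; path-acyclic; P₅-δ*; P₅-γₛ)

theorem3p4 : ((n : ℕ) → 2 Data.Nat.≤ n → (G : Graph n) → IsTree G → CNonempty G →
                 (δ : ℕ) → IsDeltaStar G δ → (γ : ℤ) → IsSignedDomNumber G γ →
                 boundNumerator n δ (numLeaves G) (numSupports G)
                   Data.Integer.≤ + boundDenominator δ * γ)
             × (Σ ℕ λ n → Σ (Graph n) λ G → Σ ℕ λ δ → Σ ℤ λ γ →
                 2 Data.Nat.≤ n × IsTree G × CNonempty G × IsDeltaStar G δ × IsSignedDomNumber G γ ×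
                 (+ boundDenominator δ * γ ≡ boundNumerator n δ (numLeaves G) (numSupports G)))
theorem3p4 =
  (λ { n 2≤n G tree _ δ (_ , δ≤deg) γ ((f , sdf , refl) , _) →
         tree-sdf-weight-bound G 2≤n tree δ δ≤deg f sdf }) ,
  (5 , P₅ , 2 , + 3 , s≤s (s≤s z≤n) , (P₅-connected , path-acyclic) , (2F , _) , P₅-δ* , P₅-γₛ , refl)
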